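{- (i) Let $\Omega\subseteq\Gamma\subseteq\mathbb{R}^e$ be such that $\Omega$ and $\Gamma$ are $A^r$-invariant. If $I$ is an $A^r$-invariant ideal of $\Omega$, then there is an $A^r$-invariant ideal $J$ of $\Gamma$ such that $J\cap\Omega=I$. (ii) Let $\Omega,\Gamma\subseteq\mathbb{R}^e$, let $I$ be an ideal of $\Omega$ and $J$ an ideal of $\Gamma$ such that $I\cap\Gamma=J\cap\Omega$. Then $I\cup J$ is an ideal of $\Omega\cup\Gamma$ if and only if $(I+\Delta)\cap\Gamma\subseteq J$ and $(J+\Delta)\cap\Omega\subseteq I$.
   Context: Let $p$ be a prime and $e,r$ positive integers with $r\mid e$. Let $P$ be the $e\times e$ matrix with entries $P_{jk}=p^{(j-k)\bmod e}$ ($1\le j,k\le e$), and let $\Delta=\{w\in\mathbb{R}^e: wP \text{ has all coordinates}\le 0\}$ (equivalently, the cone of nonnegative combinations of the rows of $(1-p^e)P^{ -1}$). For $u,v\in\mathbb{R}^e$, $u\prec v$ means $u\in v+\Delta$; this is a partial order. For $\Omega\subseteq\mathbb{R}^e$, an ideal of $\Omega$ is a subset $I\subseteq\Omega$ such that $u\in I$, $v\in\Omega$, $v\prec u$ imply $v\in I$. $A$ is the $e\times e$ circulant permutation matrix with $A_{j+1,j}=1$ ($1\le j<e$), $A_{1,e}=1$, and other entries $0$; vectors are row vectors acted on by right multiplication. A set $X\subseteq\mathbb{R}^e$ is $A^r$-invariant if $\{xA^r:x\in X\}=X$. $I+\Delta$ denotes the Minkowski sum. -}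

module Defs where

open import Level using (0ℓ)
open import Data.Nat as ℕ using (ℕ; zero; suc; _∸_; _^_)
open import Data.Nat.Base using (_≤ᵇ_; _≡ᵇ_)
open import Data.Bool using (Bool; true; false; if_then_else_; _∨_; _∧_)
open import Data.Fin using (Fin; toℕ)
open import Data.Vec using (Vec; lookup; tabulate)
open import Data.Product using (Σ; ∃; _×_; _,_)
open import Data.Sum using (_⊎_)
open import Relation.Binary.PropositionalEquality using (_≡_; _≢_)
open import Relation.Nullary using (¬_)

-- An abstract model of the real numbers: a Dedekind-complete ordered field.
-- (Any two such models are isomorphic, so quantifying over all models is
-- the same as speaking about ℝ.)
record RealField : Set₁ where
  infixl 6 _+_
  infixl 7 _*_
  infix 4 _≤_
  field
    R : Set
    _+_ _*_ : R → R → R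
    -_ : R → R
    0r 1r : R
    _≤_ : R → R → Set
    +-assoc : ∀ x y z → (x + y) + z ≡ x + (y + z)
    +-comm : ∀ x y → x + y ≡ y + x
    +-identityˡ : ∀ x → 0r + x ≡ x
    +-inverseˡ : ∀ x → (- x) + x ≡ 0r
    *-assoc : ∀ x y z → (x * y) * z ≡ x * (y * z)
    *-comm : ∀ x y → x * y ≡ y * x
    *-identityˡ : ∀ x → 1r * x ≡ x
    distribˡ : ∀ x y z → x * (y + z) ≡ x * y + x * z
    0≢1 : 0r ≢ 1r
    *-inverse : ∀ x → x ≢ 0r → Σ R (λ y → y * x ≡ 1r)
    ≤-refl : ∀ x → x ≤ x
    ≤-trans : ∀ {x y z} → x ≤ y → y ≤ z → x ≤ z
    ≤-antisym : ∀ {x y} → x ≤ y → y ≤ x → x ≡ y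
    ≤-total : ∀ x y → x ≤ y ⊎ y ≤ x
    +-mono-≤ : ∀ {x y} z → x ≤ y → x + z ≤ y + z
    *-nonneg : ∀ {x y} → 0r ≤ x → 0r ≤ y → 0r ≤ x * y
    lub : (S : R → Set) → Σ R S → Σ R (λ b → ∀ x → S x → x ≤ b) →
          Σ R (λ s → (∀ x → S x → x ≤ s) ×
                     (∀ b → (∀ x → S x → x ≤ b) → s ≤ b))

module Reals (ℛ : RealField) where
  open RealField ℛ public

  fromℕ : ℕ → R
  fromℕ zero = 0r
  fromℕ (suc n) = 1r + fromℕ n

  sumFin : ∀ n → (Fin n → R) → R
  sumFin zero f = 0r
  sumFin (suc n) f = f Fin.zero + sumFin n (λ i → f (Fin.suc i))

  Mat : ℕ → Set
  Mat e = Fin e → Fin e → R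

  vecMat : ∀ {e} → Vec R e → Mat e → Vec R e
  vecMat {e} w M = tabulate (λ k → sumFin e (λ j → lookup w j * M j k))

  matMul : ∀ {e} → Mat e → Mat e → Mat e
  matMul {e} M N i k = sumFin e (λ j → M i j * N j k)

  idMat : ∀ {e} → Mat e
  idMat i k = if toℕ i ≡ᵇ toℕ k then 1r else 0r

  matPow : ∀ {e} → Mat e → ℕ → Mat e
  matPow M zero = idMat
  matPow M (suc n) = matMul M (matPow M n)

  vadd : ∀ {e} → Vec R e → Vec R e → Vec R e
  vadd u v = tabulate (λ i → lookup u i + lookup v i)

  -- 0-indexed: P j k = p ^ ((j - k) mod e)
  Pmat : ℕ → (e : ℕ) → Mat e
  Pmat p e j k =
    fromℕ (p ^ (if toℕ k ≤ᵇ toℕ j then toℕ j ∸ toℕ k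
                                  else (e ℕ.+ toℕ j) ∸ toℕ k))

  -- 0-indexed version of A_{j+1,j} = 1 (1 ≤ j < e), A_{1,e} = 1
  Amat : (e : ℕ) → Mat e
  Amat e j k =
    if (toℕ j ≡ᵇ suc (toℕ k)) ∨ ((toℕ j ≡ᵇ 0) ∧ (suc (toℕ k) ≡ᵇ e))
    then 1r else 0r

  Subset : ℕ → Set₁
  Subset e = Vec R e → Set

  Δ : ℕ → (e : ℕ) → Subset e
  Δ p e w = ∀ k → lookup (vecMat w (Pmat p e)) k ≤ 0r

  Prec : ℕ → (e : ℕ) → Vec R e → Vec R e → Set
  Prec p e u v = Σ (Vec R e) (λ d → Δ p e d × u ≡ vadd v d)

  _⊆_ : ∀ {e} → Subset e → Subset e → Set
  X ⊆ Y = ∀ x → X x → Y x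

  _∩_ : ∀ {e} → Subset e → Subset e → Subset e
  (X ∩ Y) x = X x × Y x

  _∪_ : ∀ {e} → Subset e → Subset e → Subset e
  (X ∪ Y) x = X x ⊎ Y x

  SetEq : ∀ {e} → Subset e → Subset e → Set
  SetEq X Y = X ⊆ Y × Y ⊆ X

  minkowski : ∀ {e} → Subset e → Subset e → Subset e
  minkowski X Y z = Σ _ (λ x → Σ _ (λ y → X x × Y y × z ≡ vadd x y))

  image : ∀ {e} → Mat e → Subset e → Subset e
  image M X y = Σ _ (λ x → X x × y ≡ vecMat x M)

  Invariant : ℕ → (e : ℕ) → Subset e → Set
  Invariant r e X = SetEq (image (matPow (Amat e) r) X) X

  IsIdeal : ℕ → (e : ℕ) → Subset e → Subset e → Set
  IsIdeal p e Ω I = I ⊆ Ω × (∀ u v → I u → Ω v → Prec p e v u → I v)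

-- (ii) is pure order theory.  For (i) take J = (I + Δ) ∩ Γ, the part of Γ
-- lying below I.  It is an ideal of Γ because ≺ is a preorder (Δ is a convex
-- cone), and it meets Ω in I because I is an ideal of Ω.  It is A^r-invariant
-- because x ↦ xA^r preserves ≺ (P is circulant, so Δ is A-invariant) and has
-- finite order, so every element of J is the image of an element of J.
module Submission where

open import Defs
open import Data.Bool using (true; false; if_then_else_; _∨_; _∧_)
open import Data.Fin as Fin using (Fin; zero; suc; toℕ; punchIn)
open import Data.Nat as ℕ using (ℕ; zero; suc; _<_; _^_)
import Data.Nat.Properties as ℕₚ
open import Data.Nat.Divisibility using (_∣_)
open import Data.Nat.GeneralisedArithmetic using (fold; fold-+)
open import Data.Nat.Primality using (Prime)
open import Data.Product using (Σ; _×_; _,_; proj₁; proj₂)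
open import Data.Sum using (_⊎_; inj₁; inj₂)
open import Data.Vec using (Vec; lookup; tabulate)
open import Data.Vec.Properties using (lookup∘tabulate; tabulate∘lookup; tabulate-cong)
open import Function using (_∘_; flip; Equivalence)
open import Function.Bundles using (_⇔_; mk⇔)
open import Relation.Binary.PropositionalEquality
  using (_≡_; _≢_; refl; sym; trans; cong; cong₂; subst; module ≡-Reasoning)
open ≡-Reasoning

lookup-ext : ∀ {A : Set} {n} {u v : Vec A n} → (∀ i → lookup u i ≡ lookup v i) → u ≡ v
lookup-ext {u = u} {v} eq =
  trans (sym (tabulate∘lookup u)) (trans (tabulate-cong eq) (tabulate∘lookup v))

fold-preserves : ∀ {A : Set} (P : A → Set) {s : A → A} → (∀ x → P x → P (s x)) →
  ∀ {z} n → P z → P (fold z s n)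
fold-preserves P P-s zero    Pz = Pz
fold-preserves P P-s (suc n) Pz = P-s _ (fold-preserves P P-s n Pz)

fold-preserves₂ : ∀ {A : Set} (_∼_ : A → A → Set) {s : A → A} →
  (∀ x y → x ∼ y → s x ∼ s y) → ∀ {x y} n → x ∼ y → fold x s n ∼ fold y s n
fold-preserves₂ _∼_ s-∼ zero    x∼y = x∼y
fold-preserves₂ _∼_ s-∼ (suc n) x∼y = s-∼ _ _ (fold-preserves₂ _∼_ s-∼ n x∼y)

module CyclicShift where

  open import Data.Nat using (_+_; _*_; _∸_; _≤_; _≤ᵇ_; _≡ᵇ_; _%_; z≤n; s≤s)
  open import Data.Nat.Properties
  open import Data.Bool.Properties using (∨-identityʳ; ∧-identityʳ; ∧-zeroʳ; ¬-not; T-≡)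
  open import Data.Fin.Properties using (toℕ-injective; toℕ<n)
  open import Data.Nat.DivMod using (%-distribˡ-+; m%n%n≡m%n; n%n≡0; m<n⇒m%n≡m; %-remove-+ʳ)
  open import Data.Nat.Divisibility using (m∣m*n)

  -- k ↦ k + 1 mod suc m, defined by recursion so that sums reindex structurally.
  rot : ∀ {m} → Fin (suc m) → Fin (suc m)
  rot {zero}  zero    = zero
  rot {suc m} zero    = suc zero
  rot {suc m} (suc i) = punchIn (suc zero) (rot i)

  toℕ-rot-cases : ∀ {m} (k : Fin (suc m)) →
    (toℕ k ≡ m × toℕ (rot k) ≡ 0) ⊎ (toℕ k < m × toℕ (rot k) ≡ suc (toℕ k))
  toℕ-rot-cases {zero}  zero    = inj₁ (refl , refl)
  toℕ-rot-cases {suc m} zero    = inj₂ (s≤s z≤n , refl)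
  toℕ-rot-cases {suc m} (suc i) with rot i | toℕ-rot-cases i
  ... | zero  | inj₁ (i≡m , _)  = inj₁ (cong suc i≡m , refl)
  ... | zero  | inj₂ (_ , ())
  ... | suc _ | inj₁ (_ , ())
  ... | suc _ | inj₂ (i<m , eq) = inj₂ (s≤s i<m , cong suc eq)

  toℕ-rot : ∀ {m} (k : Fin (suc m)) → toℕ (rot k) ≡ suc (toℕ k) % suc m
  toℕ-rot {m} k with toℕ-rot-cases k
  ... | inj₁ (k≡m , eq) =
    trans eq (sym (trans (cong (λ x → suc x % suc m) k≡m) (n%n≡0 (suc m))))
  ... | inj₂ (k<m , eq) = trans eq (sym (m<n⇒m%n≡m (s≤s k<m)))

  [1+m%n]%n≡[1+m]%n : ∀ m n .{{_ : ℕ.NonZero n}} → suc (m % n) % n ≡ suc m % n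
  [1+m%n]%n≡[1+m]%n m n = begin
    (1 + m % n) % n         ≡⟨ %-distribˡ-+ 1 (m % n) n ⟩
    (1 % n + m % n % n) % n ≡⟨ cong (λ x → (1 % n + x) % n) (m%n%n≡m%n m n) ⟩
    (1 % n + m % n) % n     ≡⟨ %-distribˡ-+ 1 m n ⟨
    (1 + m) % n             ∎

  toℕ-fold-rot : ∀ {m} t (k : Fin (suc m)) → toℕ (fold k rot t) ≡ (toℕ k + t) % suc m
  toℕ-fold-rot {m} zero k =
    sym (trans (cong (_% suc m) (+-identityʳ (toℕ k))) (m<n⇒m%n≡m (toℕ<n k)))
  toℕ-fold-rot {m} (suc t) k = begin
    toℕ (rot (fold k rot t))         ≡⟨ toℕ-rot (fold k rot t) ⟩
    suc (toℕ (fold k rot t)) % suc m ≡⟨ cong (λ x → suc x % suc m) (toℕ-fold-rot t k) ⟩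
    suc ((toℕ k + t) % suc m) % suc m ≡⟨ [1+m%n]%n≡[1+m]%n (toℕ k + t) (suc m) ⟩
    suc (toℕ k + t) % suc m          ≡⟨ cong (_% suc m) (+-suc (toℕ k) t) ⟨
    (toℕ k + suc t) % suc m          ∎

  fold-rot-period : ∀ {m} c (k : Fin (suc m)) → fold k rot (suc m * c) ≡ k
  fold-rot-period {m} c k = toℕ-injective (begin
    toℕ (fold k rot (suc m * c)) ≡⟨ toℕ-fold-rot (suc m * c) k ⟩
    (toℕ k + suc m * c) % suc m  ≡⟨ %-remove-+ʳ (toℕ k) (m∣m*n c) ⟩
    toℕ k % suc m                ≡⟨ m<n⇒m%n≡m (toℕ<n k) ⟩
    toℕ k                        ∎)

  -- The exponent of p in Pmat n j k, i.e. (J − K) mod n for J, K < n.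
  offset : ℕ → ℕ → ℕ → ℕ
  offset n J K = if K ≤ᵇ J then J ∸ K else (n + J) ∸ K

  offset-≤ : ∀ n {J K} → K ≤ J → offset n J K ≡ J ∸ K
  offset-≤ n {J} {K} K≤J rewrite Equivalence.to T-≡ (≤⇒≤ᵇ K≤J) = refl

  offset-> : ∀ n {J K} → J < K → offset n J K ≡ (n + J) ∸ K
  offset-> n {J} {K} J<K
    rewrite ¬-not {K ≤ᵇ J} (λ eq → <⇒≱ J<K (≤ᵇ⇒≤ K J (Equivalence.from T-≡ eq))) = refl

  ≤ᵇ-suc : ∀ K J → (suc K ≤ᵇ suc J) ≡ (K ≤ᵇ J)
  ≤ᵇ-suc zero    J = refl
  ≤ᵇ-suc (suc K) J = refl

  offset-suc : ∀ n J K → offset n (suc J) (suc K) ≡ offset n J K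
  offset-suc n J K rewrite ≤ᵇ-suc K J | +-suc n J = refl

  offset-rot : ∀ {m} (j k : Fin (suc m)) →
    offset (suc m) (toℕ (rot j)) (toℕ (rot k)) ≡ offset (suc m) (toℕ j) (toℕ k)
  offset-rot {m} j k with toℕ-rot-cases j | toℕ-rot-cases k
  ... | inj₂ (_ , rj) | inj₂ (_ , rk) rewrite rj | rk = offset-suc (suc m) (toℕ j) (toℕ k)
  ... | inj₁ (j≡m , rj) | inj₂ (k<m , rk) rewrite rj | rk | j≡m =
    trans (cong (_∸ toℕ k) (+-identityʳ m)) (sym (offset-≤ (suc m) (<⇒≤ k<m)))
  ... | inj₂ (j<m , rj) | inj₁ (k≡m , rk) rewrite rj | rk | k≡m =
    sym (trans (offset-> (suc m) j<m) (trans (cong (_∸ m) (sym (+-suc m (toℕ j))))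
                                             (m+n∸m≡n m (suc (toℕ j)))))
  ... | inj₁ (j≡m , rj) | inj₁ (k≡m , rk) rewrite rj | rk | j≡m | k≡m =
    sym (trans (offset-≤ (suc m) {m} ≤-refl) (n∸n≡0 m))

  ≢⇒≡ᵇ≡false : ∀ {a b} → a ≢ b → (a ≡ᵇ b) ≡ false
  ≢⇒≡ᵇ≡false {a} {b} a≢b = ¬-not (λ eq → a≢b (≡ᵇ⇒≡ a b (Equivalence.from T-≡ eq)))

  ≡⇒≡ᵇ≡true : ∀ {a b} → a ≡ b → (a ≡ᵇ b) ≡ true
  ≡⇒≡ᵇ≡true {a} {b} a≡b = Equivalence.to T-≡ (≡⇒≡ᵇ a b a≡b)

  ≡ᵇ-rot : ∀ {m} (j k : Fin (suc m)) →
    ((toℕ j ≡ᵇ suc (toℕ k)) ∨ ((toℕ j ≡ᵇ 0) ∧ (suc (toℕ k) ≡ᵇ suc m)))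
      ≡ (toℕ j ≡ᵇ toℕ (rot k))
  ≡ᵇ-rot {m} j k with toℕ-rot-cases k
  ... | inj₁ (k≡m , rk)
    rewrite rk | k≡m | ≡⇒≡ᵇ≡true {m} refl
          | ≢⇒≡ᵇ≡false {toℕ j} {suc m} (λ eq → <-irrefl eq (toℕ<n j)) = ∧-identityʳ _
  ... | inj₂ (k<m , rk)
    rewrite rk | ≢⇒≡ᵇ≡false {toℕ k} {m} (λ eq → <-irrefl eq k<m)
          | ∧-zeroʳ (toℕ j ≡ᵇ 0) = ∨-identityʳ _

open CyclicShift using (rot; offset-rot; ≡ᵇ-rot; fold-rot-period)

module _ (ℛ : RealField) where
  open Reals ℛ

  +-identityʳ : ∀ x → x + 0r ≡ x
  +-identityʳ x = trans (+-comm x 0r) (+-identityˡ x)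

  *-identityʳ : ∀ x → x * 1r ≡ x
  *-identityʳ x = trans (*-comm x 1r) (*-identityˡ x)

  distribʳ : ∀ x y z → (y + z) * x ≡ y * x + z * x
  distribʳ x y z =
    trans (*-comm (y + z) x) (trans (distribˡ x y z) (cong₂ _+_ (*-comm x y) (*-comm x z)))

  x+y≡x⇒y≡0 : ∀ x y → x + y ≡ x → y ≡ 0r
  x+y≡x⇒y≡0 x y eq = begin
    y                ≡⟨ +-identityˡ y ⟨
    0r + y           ≡⟨ cong (_+ y) (+-inverseˡ x) ⟨
    ((- x) + x) + y  ≡⟨ +-assoc (- x) x y ⟩
    (- x) + (x + y)  ≡⟨ cong ((- x) +_) eq ⟩
    (- x) + x        ≡⟨ +-inverseˡ x ⟩
    0r               ∎

  *-zeroʳ : ∀ x → x * 0r ≡ 0r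
  *-zeroʳ x = x+y≡x⇒y≡0 (x * 0r) (x * 0r)
    (trans (sym (distribˡ x 0r 0r)) (cong (x *_) (+-identityˡ 0r)))

  *-zeroˡ : ∀ x → 0r * x ≡ 0r
  *-zeroˡ x = trans (*-comm 0r x) (*-zeroʳ x)

  +-interchange : ∀ a b c d → (a + b) + (c + d) ≡ (a + c) + (b + d)
  +-interchange a b c d = begin
    (a + b) + (c + d) ≡⟨ +-assoc a b (c + d) ⟩
    a + (b + (c + d)) ≡⟨ cong (a +_) (+-assoc b c d) ⟨
    a + ((b + c) + d) ≡⟨ cong (λ x → a + (x + d)) (+-comm b c) ⟩
    a + ((c + b) + d) ≡⟨ cong (a +_) (+-assoc c b d) ⟩
    a + (c + (b + d)) ≡⟨ +-assoc a c (b + d) ⟨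
    (a + c) + (b + d) ∎

  +-nonpos : ∀ {x y} → x ≤ 0r → y ≤ 0r → x + y ≤ 0r
  +-nonpos {x} {y} x≤0 y≤0 = ≤-trans (+-mono-≤ y x≤0) (subst (_≤ 0r) (sym (+-identityˡ y)) y≤0)

  sumFin-cong : ∀ n {f g : Fin n → R} → (∀ i → f i ≡ g i) → sumFin n f ≡ sumFin n g
  sumFin-cong zero    f≗g = refl
  sumFin-cong (suc n) f≗g = cong₂ _+_ (f≗g zero) (sumFin-cong n (f≗g ∘ suc))

  sumFin-zero : ∀ n → sumFin n (λ _ → 0r) ≡ 0r
  sumFin-zero zero    = refl
  sumFin-zero (suc n) = trans (cong (0r +_) (sumFin-zero n)) (+-identityˡ 0r)

  sumFin-+ : ∀ n (f g : Fin n → R) → sumFin n (λ i → f i + g i) ≡ sumFin n f + sumFin n g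
  sumFin-+ zero    f g = sym (+-identityˡ 0r)
  sumFin-+ (suc n) f g = trans (cong (f zero + g zero +_) (sumFin-+ n (f ∘ suc) (g ∘ suc)))
                               (+-interchange (f zero) (g zero) _ _)

  sumFin-*ʳ : ∀ n (f : Fin n → R) c → sumFin n (λ i → f i * c) ≡ sumFin n f * c
  sumFin-*ʳ zero    f c = sym (*-zeroˡ c)
  sumFin-*ʳ (suc n) f c =
    trans (cong (f zero * c +_) (sumFin-*ʳ n (f ∘ suc) c)) (sym (distribʳ c _ _))

  sumFin-*ˡ : ∀ n (f : Fin n → R) c → sumFin n (λ i → c * f i) ≡ c * sumFin n f
  sumFin-*ˡ n f c =
    trans (sumFin-cong n (λ i → *-comm c (f i))) (trans (sumFin-*ʳ n f c) (*-comm _ c))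

  sumFin-swap : ∀ n m (f : Fin n → Fin m → R) →
    sumFin n (λ i → sumFin m (f i)) ≡ sumFin m (λ j → sumFin n (λ i → f i j))
  sumFin-swap zero    m f = sym (sumFin-zero m)
  sumFin-swap (suc n) m f = trans (cong (sumFin m (f zero) +_) (sumFin-swap n m (f ∘ suc)))
                                  (sym (sumFin-+ m (f zero) _))

  sumFin-idMat : ∀ n (x : Fin n → R) t → sumFin n (λ j → x j * idMat j t) ≡ x t
  sumFin-idMat (suc n) x zero = trans (cong₂ _+_ (*-identityʳ (x zero))
    (trans (sumFin-cong n (λ i → *-zeroʳ (x (suc i)))) (sumFin-zero n))) (+-identityʳ _)
  sumFin-idMat (suc n) x (suc t) =
    trans (cong₂ _+_ (*-zeroʳ (x zero)) (sumFin-idMat n (x ∘ suc) t)) (+-identityˡ _)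

  sumFin-rot : ∀ {m} (g : Fin (suc m) → R) → sumFin (suc m) (g ∘ rot) ≡ sumFin (suc m) g
  sumFin-rot {zero}  g = refl
  sumFin-rot {suc m} g = begin
    g (suc zero) + sumFin (suc m) (g ∘ punchIn (suc zero) ∘ rot)
      ≡⟨ cong (g (suc zero) +_) (sumFin-rot (g ∘ punchIn (suc zero))) ⟩
    g (suc zero) + (g zero + rest) ≡⟨ +-assoc _ _ rest ⟨
    (g (suc zero) + g zero) + rest ≡⟨ cong (_+ rest) (+-comm _ _) ⟩
    (g zero + g (suc zero)) + rest ≡⟨ +-assoc _ _ rest ⟩
    g zero + (g (suc zero) + rest) ∎
    where rest = sumFin m (g ∘ Fin.suc ∘ Fin.suc)

  lookup-vecMat : ∀ {n} (x : Vec R n) (M : Mat n) k →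
    lookup (vecMat x M) k ≡ sumFin n (λ j → lookup x j * M j k)
  lookup-vecMat {n} x M = lookup∘tabulate (λ k → sumFin n (λ j → lookup x j * M j k))

  lookup-vadd : ∀ {n} (u v : Vec R n) i → lookup (vadd u v) i ≡ lookup u i + lookup v i
  lookup-vadd u v = lookup∘tabulate (λ i → lookup u i + lookup v i)

  vadd-assoc : ∀ {n} (u v w : Vec R n) → vadd (vadd u v) w ≡ vadd u (vadd v w)
  vadd-assoc u v w = lookup-ext λ i → begin
    lookup (vadd (vadd u v) w) i             ≡⟨ lookup-vadd (vadd u v) w i ⟩
    lookup (vadd u v) i + lookup w i         ≡⟨ cong (_+ lookup w i) (lookup-vadd u v i) ⟩
    (lookup u i + lookup v i) + lookup w i   ≡⟨ +-assoc _ _ _ ⟩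
    lookup u i + (lookup v i + lookup w i)   ≡⟨ cong (lookup u i +_) (lookup-vadd v w i) ⟨
    lookup u i + lookup (vadd v w) i         ≡⟨ lookup-vadd u (vadd v w) i ⟨
    lookup (vadd u (vadd v w)) i             ∎

  vecMat-vadd : ∀ {n} (u v : Vec R n) (M : Mat n) →
    vecMat (vadd u v) M ≡ vadd (vecMat u M) (vecMat v M)
  vecMat-vadd {n} u v M = lookup-ext λ k → begin
    lookup (vecMat (vadd u v) M) k
      ≡⟨ lookup-vecMat (vadd u v) M k ⟩
    sumFin n (λ j → lookup (vadd u v) j * M j k)
      ≡⟨ sumFin-cong n (λ j → trans (cong (_* M j k) (lookup-vadd u v j)) (distribʳ _ _ _)) ⟩
    sumFin n (λ j → lookup u j * M j k + lookup v j * M j k)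
      ≡⟨ sumFin-+ n _ _ ⟩
    sumFin n (λ j → lookup u j * M j k) + sumFin n (λ j → lookup v j * M j k)
      ≡⟨ cong₂ _+_ (lookup-vecMat u M k) (lookup-vecMat v M k) ⟨
    lookup (vecMat u M) k + lookup (vecMat v M) k
      ≡⟨ lookup-vadd (vecMat u M) (vecMat v M) k ⟨
    lookup (vadd (vecMat u M) (vecMat v M)) k ∎

  vecMat-idMat : ∀ {n} (x : Vec R n) → vecMat x idMat ≡ x
  vecMat-idMat {n} x = lookup-ext λ k → trans (lookup-vecMat x idMat k) (sumFin-idMat n (lookup x) k)

  vecMat-matMul : ∀ {n} (x : Vec R n) (A B : Mat n) → vecMat x (matMul A B) ≡ vecMat (vecMat x A) B
  vecMat-matMul {n} x A B = lookup-ext λ k → begin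
    lookup (vecMat x (matMul A B)) k
      ≡⟨ lookup-vecMat x (matMul A B) k ⟩
    sumFin n (λ j → lookup x j * sumFin n (λ l → A j l * B l k))
      ≡⟨ sumFin-cong n (λ j → sumFin-*ˡ n (λ l → A j l * B l k) (lookup x j)) ⟨
    sumFin n (λ j → sumFin n (λ l → lookup x j * (A j l * B l k)))
      ≡⟨ sumFin-swap n n (λ j l → lookup x j * (A j l * B l k)) ⟩
    sumFin n (λ l → sumFin n (λ j → lookup x j * (A j l * B l k)))
      ≡⟨ sumFin-cong n (λ l → trans (sumFin-cong n (λ j → sym (*-assoc _ _ _)))
                                    (sumFin-*ʳ n (λ j → lookup x j * A j l) (B l k))) ⟩
    sumFin n (λ l → sumFin n (λ j → lookup x j * A j l) * B l k)
      ≡⟨ sumFin-cong n (λ l → cong (_* B l k) (lookup-vecMat x A l)) ⟨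
    sumFin n (λ l → lookup (vecMat x A) l * B l k)
      ≡⟨ lookup-vecMat (vecMat x A) B k ⟨
    lookup (vecMat (vecMat x A) B) k ∎

  lookup-vecMat-Amat : ∀ {m} (x : Vec R (suc m)) k →
    lookup (vecMat x (Amat (suc m))) k ≡ lookup x (rot k)
  lookup-vecMat-Amat {m} x k = begin
    lookup (vecMat x (Amat (suc m))) k
      ≡⟨ lookup-vecMat x (Amat (suc m)) k ⟩
    sumFin (suc m) (λ j → lookup x j * Amat (suc m) j k)
      ≡⟨ sumFin-cong (suc m) (λ j → cong (λ b → lookup x j * (if b then 1r else 0r)) (≡ᵇ-rot j k)) ⟩
    sumFin (suc m) (λ j → lookup x j * idMat j (rot k))
      ≡⟨ sumFin-idMat (suc m) (lookup x) (rot k) ⟩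
    lookup x (rot k) ∎

  lookup-vecMat-matPow-Amat : ∀ {m} t (x : Vec R (suc m)) k →
    lookup (vecMat x (matPow (Amat (suc m)) t)) k ≡ lookup x (fold k rot t)
  lookup-vecMat-matPow-Amat zero    x k = cong (λ y → lookup y k) (vecMat-idMat x)
  lookup-vecMat-matPow-Amat {m} (suc t) x k = begin
    lookup (vecMat x (matMul (Amat (suc m)) (matPow (Amat (suc m)) t))) k
      ≡⟨ cong (λ y → lookup y k) (vecMat-matMul x (Amat (suc m)) (matPow (Amat (suc m)) t)) ⟩
    lookup (vecMat (vecMat x (Amat (suc m))) (matPow (Amat (suc m)) t)) k
      ≡⟨ lookup-vecMat-matPow-Amat t (vecMat x (Amat (suc m))) k ⟩
    lookup (vecMat x (Amat (suc m))) (fold k rot t)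
      ≡⟨ lookup-vecMat-Amat x (fold k rot t) ⟩
    lookup x (rot (fold k rot t)) ∎

  lookup-fold-vecMat-matPow-Amat : ∀ {m} r N (x : Vec R (suc m)) k →
    lookup (fold x (flip vecMat (matPow (Amat (suc m)) r)) N) k ≡ lookup x (fold k rot (N ℕ.* r))
  lookup-fold-vecMat-matPow-Amat r zero    x k = refl
  lookup-fold-vecMat-matPow-Amat {m} r (suc N) x k = begin
    lookup (vecMat (fold x T N) (matPow (Amat (suc m)) r)) k
      ≡⟨ lookup-vecMat-matPow-Amat r (fold x T N) k ⟩
    lookup (fold x T N) (fold k rot r)
      ≡⟨ lookup-fold-vecMat-matPow-Amat r N x (fold k rot r) ⟩
    lookup x (fold (fold k rot r) rot (N ℕ.* r))
      ≡⟨ cong (lookup x) (fold-+ k rot (N ℕ.* r)) ⟨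
    lookup x (fold k rot (N ℕ.* r ℕ.+ r))
      ≡⟨ cong (λ t → lookup x (fold k rot t)) (ℕₚ.+-comm (N ℕ.* r) r) ⟩
    lookup x (fold k rot (suc N ℕ.* r)) ∎
    where T = flip vecMat (matPow (Amat (suc m)) r)

  vecMat-matPow-Amat-period : ∀ {m} r (x : Vec R (suc m)) →
    fold x (flip vecMat (matPow (Amat (suc m)) r)) (suc m) ≡ x
  vecMat-matPow-Amat-period {m} r x = lookup-ext λ k →
    trans (lookup-fold-vecMat-matPow-Amat r (suc m) x k) (cong (lookup x) (fold-rot-period r k))

  zeroVec : ∀ {n} → Vec R n
  zeroVec = tabulate λ _ → 0r

  Δ-zero : ∀ p n → Δ p n zeroVec
  Δ-zero p n k = subst (_≤ 0r) (sym (begin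
    lookup (vecMat zeroVec (Pmat p n)) k
      ≡⟨ lookup-vecMat zeroVec (Pmat p n) k ⟩
    sumFin n (λ j → lookup zeroVec j * Pmat p n j k)
      ≡⟨ sumFin-cong n (λ j → trans (cong (_* Pmat p n j k) (lookup∘tabulate _ j)) (*-zeroˡ _)) ⟩
    sumFin n (λ _ → 0r)
      ≡⟨ sumFin-zero n ⟩
    0r ∎)) (≤-refl 0r)

  Δ-vadd : ∀ p n u v → Δ p n u → Δ p n v → Δ p n (vadd u v)
  Δ-vadd p n u v Δu Δv k =
    subst (_≤ 0r) (sym (trans (cong (λ w → lookup w k) (vecMat-vadd u v (Pmat p n)))
                              (lookup-vadd (vecMat u (Pmat p n)) (vecMat v (Pmat p n)) k)))
          (+-nonpos (Δu k) (Δv k))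

  Pmat-rot : ∀ p {m} (j k : Fin (suc m)) → Pmat p (suc m) (rot j) (rot k) ≡ Pmat p (suc m) j k
  Pmat-rot p j k = cong (λ t → fromℕ (p ^ t)) (offset-rot j k)

  -- Since P is circulant, (dA)P is dP with its coordinates rotated.
  Δ-vecMat-Amat : ∀ p {m} d → Δ p (suc m) d → Δ p (suc m) (vecMat d (Amat (suc m)))
  Δ-vecMat-Amat p {m} d Δd k = subst (_≤ 0r) (sym (begin
    lookup (vecMat (vecMat d A) P) k
      ≡⟨ lookup-vecMat (vecMat d A) P k ⟩
    sumFin (suc m) (λ j → lookup (vecMat d A) j * P j k)
      ≡⟨ sumFin-cong (suc m) (λ j → cong₂ _*_ (lookup-vecMat-Amat d j) (sym (Pmat-rot p j k))) ⟩
    sumFin (suc m) (λ j → lookup d (rot j) * P (rot j) (rot k))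
      ≡⟨ sumFin-rot (λ l → lookup d l * P l (rot k)) ⟩
    sumFin (suc m) (λ l → lookup d l * P l (rot k))
      ≡⟨ lookup-vecMat d P (rot k) ⟨
    lookup (vecMat d P) (rot k) ∎)) (Δd (rot k))
    where
    A = Amat (suc m)
    P = Pmat p (suc m)

  Δ-vecMat-matPow : ∀ p {n} (M : Mat n) → (∀ d → Δ p n d → Δ p n (vecMat d M)) →
    ∀ t d → Δ p n d → Δ p n (vecMat d (matPow M t))
  Δ-vecMat-matPow p M Δ-M zero    d Δd = subst (Δ p _) (sym (vecMat-idMat d)) Δd
  Δ-vecMat-matPow p M Δ-M (suc t) d Δd = subst (Δ p _) (sym (vecMat-matMul d M (matPow M t)))
    (Δ-vecMat-matPow p M Δ-M t (vecMat d M) (Δ-M d Δd))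

  Prec-refl : ∀ p n u → Prec p n u u
  Prec-refl p n u = zeroVec , Δ-zero p n , lookup-ext λ i →
    sym (trans (lookup-vadd u zeroVec i)
               (trans (cong (lookup u i +_) (lookup∘tabulate _ i)) (+-identityʳ _)))

  Prec-trans : ∀ p n u v w → Prec p n u v → Prec p n v w → Prec p n u w
  Prec-trans p n u v w (d , Δd , u≡v+d) (d′ , Δd′ , v≡w+d′) =
    vadd d′ d , Δ-vadd p n d′ d Δd′ Δd ,
    trans u≡v+d (trans (cong (λ x → vadd x d) v≡w+d′) (vadd-assoc w d′ d))

  Prec-vecMat : ∀ p {n} (M : Mat n) → (∀ d → Δ p n d → Δ p n (vecMat d M)) →
    ∀ v u → Prec p n v u → Prec p n (vecMat v M) (vecMat u M)
  Prec-vecMat p M Δ-M v u (d , Δd , v≡u+d) =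
    vecMat d M , Δ-M d Δd , trans (cong (flip vecMat M) v≡u+d) (vecMat-vadd u d M)

  invariant-ideal-extension : ∀ p {n} (M : Mat n) → (∀ d → Δ p n d → Δ p n (vecMat d M)) →
    ∀ N → (∀ x → fold x (flip vecMat M) (suc N) ≡ x) →
    (Ω Γ I : Subset n) → Ω ⊆ Γ → image M Γ ⊆ Γ → IsIdeal p n Ω I → image M I ⊆ I →
    Σ (Subset n) (λ J → IsIdeal p n Γ J × SetEq (image M J) J × SetEq (J ∩ Ω) I)
  invariant-ideal-extension p {n} M Δ-M N period Ω Γ I Ω⊆Γ MΓ⊆Γ (I⊆Ω , I-lower) MI⊆I =
    J , (J⊆Γ , J-lower) , (MJ⊆J , J⊆MJ) , (J∩Ω⊆I , I⊆J∩Ω)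
    where
    J : Subset n
    J = minkowski I (Δ p n) ∩ Γ

    J⊆Γ : J ⊆ Γ
    J⊆Γ _ = proj₂

    J-lower : ∀ u v → J u → Γ v → Prec p n v u → J v
    J-lower u v ((w , d , Iw , Δd , u≡w+d) , _) Γv v≺u
      with Prec-trans p n v u w v≺u (d , Δd , u≡w+d)
    ... | d′ , Δd′ , v≡w+d′ = (w , d′ , Iw , Δd′ , v≡w+d′) , Γv

    T : Vec R n → Vec R n
    T = flip vecMat M

    T-Γ : ∀ x → Γ x → Γ (T x)
    T-Γ x Γx = MΓ⊆Γ (T x) (x , Γx , refl)

    T-I : ∀ x → I x → I (T x)
    T-I x Ix = MI⊆I (T x) (x , Ix , refl)

    MJ⊆J : image M J ⊆ J
    MJ⊆J _ (x , ((w , d , Iw , Δd , x≡w+d) , Γx) , refl)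
      with Prec-vecMat p M Δ-M x w (d , Δd , x≡w+d)
    ... | d′ , Δd′ , Tx≡Tw+d′ = (T w , d′ , T-I w Iw , Δd′ , Tx≡Tw+d′) , T-Γ x Γx

    -- T has order dividing suc N, so T^N is its inverse.
    J⊆MJ : J ⊆ image M J
    J⊆MJ γ ((w , d , Iw , Δd , γ≡w+d) , Γγ)
      with fold-preserves₂ (Prec p n) (Prec-vecMat p M Δ-M) N (d , Δd , γ≡w+d)
    ... | d′ , Δd′ , eq =
      fold γ T N ,
      ((fold w T N , d′ , fold-preserves I T-I N Iw , Δd′ , eq) , fold-preserves Γ T-Γ N Γγ) ,
      sym (period γ)

    J∩Ω⊆I : (J ∩ Ω) ⊆ I
    J∩Ω⊆I γ (((w , d , Iw , Δd , γ≡w+d) , _) , Ωγ) = I-lower w γ Iw Ωγ (d , Δd , γ≡w+d)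

    I⊆J∩Ω : I ⊆ (J ∩ Ω)
    I⊆J∩Ω u Iu with Prec-refl p n u
    ... | d , Δd , u≡u+d = ((u , d , Iu , Δd , u≡u+d) , Ω⊆Γ u (I⊆Ω u Iu)) , I⊆Ω u Iu

  ideal-union⇔ : ∀ p n (Ω Γ I J : Subset n) → IsIdeal p n Ω I → IsIdeal p n Γ J →
    SetEq (I ∩ Γ) (J ∩ Ω) →
    IsIdeal p n (Ω ∪ Γ) (I ∪ J) ⇔
      ((minkowski I (Δ p n) ∩ Γ) ⊆ J × (minkowski J (Δ p n) ∩ Ω) ⊆ I)
  ideal-union⇔ p n Ω Γ I J (I⊆Ω , I-lower) (J⊆Γ , J-lower) (I∩Γ⊆J∩Ω , J∩Ω⊆I∩Γ) =
    mk⇔ to from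
    where
    to : IsIdeal p n (Ω ∪ Γ) (I ∪ J) →
         (minkowski I (Δ p n) ∩ Γ) ⊆ J × (minkowski J (Δ p n) ∩ Ω) ⊆ I
    to (_ , I∪J-lower) = I+Δ∩Γ⊆J , J+Δ∩Ω⊆I
      where
      I+Δ∩Γ⊆J : (minkowski I (Δ p n) ∩ Γ) ⊆ J
      I+Δ∩Γ⊆J z ((x , d , Ix , Δd , z≡x+d) , Γz)
        with I∪J-lower x z (inj₁ Ix) (inj₂ Γz) (d , Δd , z≡x+d)
      ... | inj₁ Iz = proj₁ (I∩Γ⊆J∩Ω z (Iz , Γz))
      ... | inj₂ Jz = Jz
      J+Δ∩Ω⊆I : (minkowski J (Δ p n) ∩ Ω) ⊆ I
      J+Δ∩Ω⊆I z ((x , d , Jx , Δd , z≡x+d) , Ωz)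
        with I∪J-lower x z (inj₂ Jx) (inj₁ Ωz) (d , Δd , z≡x+d)
      ... | inj₁ Iz = Iz
      ... | inj₂ Jz = proj₁ (J∩Ω⊆I∩Γ z (Jz , Ωz))
    from : (minkowski I (Δ p n) ∩ Γ) ⊆ J × (minkowski J (Δ p n) ∩ Ω) ⊆ I →
           IsIdeal p n (Ω ∪ Γ) (I ∪ J)
    from (I+Δ∩Γ⊆J , J+Δ∩Ω⊆I) = I∪J⊆Ω∪Γ , I∪J-lower
      where
      I∪J⊆Ω∪Γ : (I ∪ J) ⊆ (Ω ∪ Γ)
      I∪J⊆Ω∪Γ u (inj₁ Iu) = inj₁ (I⊆Ω u Iu)
      I∪J⊆Ω∪Γ u (inj₂ Ju) = inj₂ (J⊆Γ u Ju)
      I∪J-lower : ∀ u v → (I ∪ J) u → (Ω ∪ Γ) v → Prec p n v u → (I ∪ J) v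
      I∪J-lower u v (inj₁ Iu) (inj₁ Ωv) v≺u = inj₁ (I-lower u v Iu Ωv v≺u)
      I∪J-lower u v (inj₂ Ju) (inj₂ Γv) v≺u = inj₂ (J-lower u v Ju Γv v≺u)
      I∪J-lower u v (inj₁ Iu) (inj₂ Γv) (d , Δd , v≡u+d) =
        inj₂ (I+Δ∩Γ⊆J v ((u , d , Iu , Δd , v≡u+d) , Γv))
      I∪J-lower u v (inj₂ Ju) (inj₁ Ωv) (d , Δd , v≡u+d) =
        inj₁ (J+Δ∩Ω⊆I v ((u , d , Ju , Δd , v≡u+d) , Ωv))

lemma2p1 : (ℛ : RealField) → let open Reals ℛ in
    (p e r : ℕ) → Prime p → 0 < e → 0 < r → r ∣ e →
    ((Ω Γ I : Subset e) → Ω ⊆ Γ → Invariant r e Ω → Invariant r e Γ →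
      IsIdeal p e Ω I → Invariant r e I →
      Σ (Subset e) (λ J → IsIdeal p e Γ J × Invariant r e J × SetEq (J ∩ Ω) I))
    ×
    ((Ω Γ I J : Subset e) → IsIdeal p e Ω I → IsIdeal p e Γ J →
      SetEq (I ∩ Γ) (J ∩ Ω) →
      (IsIdeal p e (Ω ∪ Γ) (I ∪ J) ⇔
        ((minkowski I (Δ p e) ∩ Γ) ⊆ J × (minkowski J (Δ p e) ∩ Ω) ⊆ I)))
lemma2p1 ℛ p zero    r _ () _ _
lemma2p1 ℛ p (suc m) r _ _ _ _ =
    (λ Ω Γ I Ω⊆Γ _ invΓ I-ideal invI →
      invariant-ideal-extension ℛ p (matPow (Amat (suc m)) r)
        (Δ-vecMat-matPow ℛ p (Amat (suc m)) (Δ-vecMat-Amat ℛ p) r) m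
        (vecMat-matPow-Amat-period ℛ r) Ω Γ I Ω⊆Γ (proj₁ invΓ) I-ideal (proj₁ invI))
  , ideal-union⇔ ℛ p (suc m)
  where open Reals ℛ
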